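{- For all packed words $u,v$, $$\Delta(u*v)=\Delta(u)*^{\otimes 2}\Delta(v),$$ where $*^{\otimes2}$ is the product on $\mathcal H\otimes\mathcal H$ given by $(a\otimes b)*^{\otimes 2}(c\otimes d)=(a*c)\otimes(b*d)$, extended bilinearly.
   Context: $X=\{x_i\}_{i\ge 0}$ is an alphabet totally ordered by index, $X^*$ the free monoid of words over $X$ with empty word $1_{X^*}$. For a word $w$, $|w|$ is its length, $w[i]$ its $i$-th letter, $IAlph(w)=\{i\in\mathbb N: x_i\text{ occurs in }w\}$, $Alph(w)=\{x_i: i\in IAlph(w)\}$, $sup(w)$ the supremum of $IAlph(w)$ in $\mathbb N$ ($sup(1_{X^*})=0$). For $\phi$ on $IAlph(w)$ with values in $\mathbb N$ and $\phi(0)=0$, $S_\phi(x_{i_1}\cdots x_{i_m})=x_{\phi(i_1)}\cdots x_{\phi(i_m)}$. If $IAlph(w)\setminus\{0\}=\{j_1<\dots<j_k\}$, let $\phi_w(j_m)=m$, $\phi_w(0)=0$, $pack(w)=S_{\phi_w}(w)$; $w$ is packed if $pack(w)=w$. $T_t(w)=S_\phi(w)$ with $\phi(n)=n+t$ for $n>0$, $\phi(0)=0$. Shifted concatenation: $u*v=u\,T_{sup(u)}(v)$. $\mathcal H$ is the vector space over a field $k$ with basis the packed words, with product $*$ extended bilinearly. For $I=\{i_1<\dots<i_l\}\subseteq[1\dots|w|]$, $w[I]=w[i_1]\cdots w[i_l]$. For $A\subseteq X$, $w/A=S_{\phi_A}(w)$ with $\phi_A(i)=0$ if $x_i\in A$,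 $\phi_A(i)=i$ otherwise; $w/u:=w/Alph(u)$. The coproduct $\Delta:\mathcal H\to\mathcal H\otimes\mathcal H$ is $\Delta(w)=\sum_{I+J=[1\dots|w|]}pack(w[I])\otimes pack(w[J]/w[I])$ over ordered pairs of disjoint (possibly empty) subsets $I,J$ with union $[1\dots|w|]$, extended linearly. -}

module Defs where

open import Level using (Level; _⊔_) renaming (suc to lsuc)
open import Data.Nat as ℕ using (ℕ; zero; suc; _+_; _≟_; _≤?_)
open import Data.Bool using (Bool; true; false; if_then_else_)
open import Data.List using (List; []; _∷_; _++_; map; filter; length; foldr; concatMap; upTo)
open import Data.List.Membership.DecPropositional _≟_ using (_∈?_)
open import Data.Product using (_×_; _,_; Σ)
open import Relation.Nullary using (¬_; does)
open import Relation.Binary.PropositionalEquality using (_≡_)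
open import Algebra.Bundles using (CommutativeRing)

record Field (c ℓ : Level) : Set (lsuc (c ⊔ ℓ)) where
  field
    commutativeRing : CommutativeRing c ℓ
  open CommutativeRing commutativeRing public
  field
    1≉0     : ¬ (1# ≈ 0#)
    inverse : ∀ x → ¬ (x ≈ 0#) → Σ Carrier (λ y → (x * y) ≈ 1#)

-- Words: the letter x_i is represented by the natural number i.

Word : Set
Word = List ℕ

sup : Word → ℕ
sup = foldr ℕ._⊔_ 0

occurs : ℕ → Word → Bool
occurs i w = does (i ∈? w)

-- φ_w(j) = number of nonzero indices i ∈ IAlph(w) with i ≤ j
-- (rank of j among the nonzero indices of w), and φ_w(0) = 0
φ : Word → ℕ → ℕ
φ w zero    = zero
φ w (suc j) = length (filter (λ i → i ∈? w) (map suc (upTo (suc j))))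

pack : Word → Word
pack w = map (φ w) w

IsPacked : Word → Set
IsPacked w = pack w ≡ w

T : ℕ → Word → Word
T t = map (λ { zero → zero ; (suc n) → suc n + t })

_✶_ : Word → Word → Word
u ✶ v = u ++ T (sup u) v

_/ʷ_ : Word → Word → Word
w /ʷ u = map (λ i → if occurs i u then 0 else i) w

-- Ordered pairs (I , J) with I + J = [1..|w|]: a mask b of length |w|,
-- I = positions marked true, J = positions marked false.

masks : ℕ → List (List Bool)
masks zero    = [] ∷ []
masks (suc n) = concatMap (λ m → (true ∷ m) ∷ (false ∷ m) ∷ []) (masks n)

select : List Bool → Word → Word
select (true  ∷ bs) (x ∷ w) = x ∷ select bs w
select (false ∷ bs) (x ∷ w) = select bs w
select _ _ = []

negate : List Bool → List Bool
negate = map (λ { true → false ; false → true })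

-- Elements of H ⊗ H with nonnegative integer coefficients are represented
-- as formal sums (lists) of basis tensors a ⊗ b (pairs of packed words);
-- each list entry contributes coefficient 1.

Tensor : Set
Tensor = List (Word × Word)

Δ : Word → Tensor
Δ w = map (λ b → pack (select b w) , pack (select (negate b) w /ʷ select b w))
          (masks (length w))

_✶⊗_ : Tensor → Tensor → Tensor
X ✶⊗ Y = concatMap (λ { (a , b) → map (λ { (c , d) → (a ✶ c , b ✶ d) }) Y }) X

_==ᵗ_ : Word × Word → Word × Word → Bool
(a , b) ==ᵗ (c , d) = does (Data.List.Properties.≡-dec _≟_ a c) Data.Bool.∧ does (Data.List.Properties.≡-dec _≟_ b d)
  where import Data.List.Properties
        import Data.Bool

coeff : ∀ {c ℓ} (K : Field c ℓ) → Word × Word → Tensor → Field.Carrier K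
coeff K p = foldr (λ q acc → if q ==ᵗ p then Field._+_ K (Field.1# K) acc else acc) (Field.0# K)

module Submission where

-- The identity holds for all words u, v.  A term of
-- Δ(w) is indexed by a mask b of length |w| (I = positions marked true).  Masks
-- of u * v are exactly the concatenations b₁ ++ b₂ of a mask of u and a mask
-- of v, and the term of u * v at b₁ ++ b₂ is the product of the term of u at
-- b₁ with the term of v at b₂.  The latter rests on two facts about a word
-- A ++ T_s(B) whose left part A only uses letters ≤ s:
--   * pack(A ++ T_s B) = pack A * pack B   (packing splits across the shift),
--   * (A' ++ T_s B') / (A ++ T_s B) = (A' / A) ++ T_s (B' / B).
-- Packing is analysed through the rank function φ_w(j) = #{i ∈ [1..j] : x_i ∈ w}.
-- Hence Δ(u * v) is a permutation of the formal sum Δ(u) *⊗ Δ(v), and the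
-- coefficient of a basis tensor is invariant under permutation of a formal sum.

open import Defs
open import Level using (Level)
open import Data.List using (List)
open import Data.Product using (_×_)

open import Data.Nat using (ℕ; zero; suc; _+_; _∸_; _≤_; _<_; _≡ᵇ_; z≤n; s≤s)
open import Data.Nat.Properties
  using (+-comm; +-assoc; +-identityʳ; ≤-refl; ≤-trans; ≤-<-trans; m≤m+n; m≤n+m; m∸n+n≡m;
         m≤m⊔n; m≤n⊔m; ⊔-lub; mono-≤-distrib-⊔; n<1+n; m<n⇒m<1+n; <⇒≢; >⇒≢; suc-injective; ≡ᵇ⇒≡)
open import Data.Bool using (Bool; true; false; if_then_else_; _∨_) renaming (T to IsTrue)
open import Data.Bool.Properties using (∨-assoc; ∨-identityʳ; ∨-zeroʳ; if-eta)
open import Data.Unit using (tt)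
open import Data.Empty using (⊥-elim)
open import Data.List using ([]; _∷_; _++_; map; filter; length; concat; concatMap; upTo)
open import Data.List.Properties
  using (map-++; filter-++; length-++; length-map; upTo-∷ʳ; map-∘; map-cong; map-cong-local; map-id;
         ++-assoc; ++-identityʳ; concatMap-++; concatMap-map; map-concatMap)
open import Data.List.Relation.Unary.All as All using (All; []; _∷_)
import Data.List.Relation.Unary.All.Properties as Allₚ
open import Data.List.Relation.Binary.Permutation.Propositional as ↭
  using (_↭_; prep; swap; ↭-sym; ↭-reflexive; module PermutationReasoning)
open import Data.List.Relation.Binary.Permutation.Propositional.Properties using (++⁺; ++⁺ˡ; shift; shifts; map⁺)
open import Data.List.Membership.DecPropositional Data.Nat._≟_ using (_∈?_)
open import Data.Product using (_,_)
open import Relation.Nullary using (does)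
open import Relation.Binary.PropositionalEquality

-- Letters of a word bounded by s; the left factor of u * v is bounded by sup u.
Bounded : ℕ → Word → Set
Bounded s = All (_≤ s)

bounded-sup : ∀ w → Bounded (sup w) w
bounded-sup []      = []
bounded-sup (x ∷ w) = m≤m⊔n x (sup w) ∷ All.map (λ p → ≤-trans p (m≤n⊔m x (sup w))) (bounded-sup w)

sup-bounded : ∀ {s} w → Bounded s w → sup w ≤ s
sup-bounded []      []       = z≤n
sup-bounded (x ∷ w) (p ∷ ps) = ⊔-lub p (sup-bounded w ps)

sup-map : ∀ (f : ℕ → ℕ) → (∀ {x y} → x ≤ y → f x ≤ f y) → f 0 ≡ 0 →
          ∀ w → sup (map f w) ≡ f (sup w)
sup-map f mono f0 []      = sym f0
sup-map f mono f0 (x ∷ w) rewrite sup-map f mono f0 w = sym (mono-≤-distrib-⊔ mono x (sup w))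

≡ᵇ-refl : ∀ n → (n ≡ᵇ n) ≡ true
≡ᵇ-refl zero    = refl
≡ᵇ-refl (suc n) = ≡ᵇ-refl n

≢⇒≡ᵇ-false : ∀ {m n} → m ≢ n → (m ≡ᵇ n) ≡ false
≢⇒≡ᵇ-false {m} {n} m≢n with m ≡ᵇ n in eq
... | true  = ⊥-elim (m≢n (≡ᵇ⇒≡ m n (subst IsTrue (sym eq) tt)))
... | false = refl

≡ᵇ-+ʳ : ∀ s a b → (a + s ≡ᵇ b + s) ≡ (a ≡ᵇ b)
≡ᵇ-+ʳ s a b rewrite +-comm a s | +-comm b s = go s
  where
  go : ∀ t → (t + a ≡ᵇ t + b) ≡ (a ≡ᵇ b)
  go zero    = refl
  go (suc t) = go t

occurs-++ : ∀ i A B → occurs i (A ++ B) ≡ (occurs i A ∨ occurs i B)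
occurs-++ i []      B = refl
occurs-++ i (x ∷ A) B rewrite occurs-++ i A B = sym (∨-assoc (i ≡ᵇ x) (occurs i A) (occurs i B))

occurs-beyond-sup : ∀ i A → sup A < i → occurs i A ≡ false
occurs-beyond-sup i []      _ = refl
occurs-beyond-sup i (x ∷ A) p
  rewrite ≢⇒≡ᵇ-false (>⇒≢ (≤-<-trans (m≤m⊔n x (sup A)) p)) = occurs-beyond-sup i A (≤-<-trans (m≤n⊔m x (sup A)) p)

occurs-self : ∀ B → All (λ y → occurs y B ≡ true) B
occurs-self []      = []
occurs-self (x ∷ B) = head ∷ All.map (λ {y} p → tail y p) (occurs-self B)
  where
  head : ((x ≡ᵇ x) ∨ occurs x B) ≡ true
  head rewrite ≡ᵇ-refl x = refl
  tail : ∀ y → occurs y B ≡ true → ((y ≡ᵇ x) ∨ occurs y B) ≡ true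
  tail y p rewrite p = ∨-zeroʳ (y ≡ᵇ x)

shiftLetter : ℕ → ℕ → ℕ
shiftLetter t zero    = zero
shiftLetter t (suc n) = suc n + t

T≡map-shiftLetter : ∀ t w → T t w ≡ map (shiftLetter t) w
T≡map-shiftLetter t []          = refl
T≡map-shiftLetter t (zero ∷ w)  = cong (zero ∷_) (T≡map-shiftLetter t w)
T≡map-shiftLetter t (suc x ∷ w) = cong (suc x + t ∷_) (T≡map-shiftLetter t w)

occurs-shift-low : ∀ i s B → suc i ≤ s → occurs (suc i) (map (shiftLetter s) B) ≡ false
occurs-shift-low i s []          _ = refl
occurs-shift-low i s (zero ∷ B)  p = occurs-shift-low i s B p
occurs-shift-low i s (suc n ∷ B) p
  rewrite ≢⇒≡ᵇ-false (<⇒≢ (≤-trans p (m≤n+m s n))) = occurs-shift-low i s B p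

occurs-shift-high : ∀ k s B → occurs (suc k + s) (map (shiftLetter s) B) ≡ occurs (suc k) B
occurs-shift-high k s []          = refl
occurs-shift-high k s (zero ∷ B)  = occurs-shift-high k s B
occurs-shift-high k s (suc n ∷ B) rewrite ≡ᵇ-+ʳ s k n | occurs-shift-high k s B = refl

occurs-concat-low : ∀ s A B i → suc i ≤ s →
                    occurs (suc i) (A ++ map (shiftLetter s) B) ≡ occurs (suc i) A
occurs-concat-low s A B i p
  rewrite occurs-++ (suc i) A (map (shiftLetter s) B) | occurs-shift-low i s B p = ∨-identityʳ _

occurs-concat-high : ∀ s A B k → Bounded s A →
                     occurs (suc k + s) (A ++ map (shiftLetter s) B) ≡ occurs (suc k) B
occurs-concat-high s A B k bA
  rewrite occurs-++ (suc k + s) A (map (shiftLetter s) B)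
        | occurs-beyond-sup (suc k + s) A (s≤s (≤-trans (sup-bounded A bA) (m≤n+m s k)))
        = occurs-shift-high k s B

rank : Word → ℕ → ℕ
rank w j = length (filter (_∈? w) (map suc (upTo j)))

φ≡rank : ∀ w j → φ w j ≡ rank w j
φ≡rank w zero    = refl
φ≡rank w (suc j) = refl

indicator : Bool → ℕ
indicator true  = 1
indicator false = 0

rank-suc : ∀ w j → rank w (suc j) ≡ rank w j + indicator (occurs (suc j) w)
rank-suc w j = begin
  rank w (suc j)
    ≡⟨ cong (λ l → length (filter (_∈? w) (map suc l))) (sym (upTo-∷ʳ j)) ⟩
  length (filter (_∈? w) (map suc (upTo j ++ j ∷ [])))
    ≡⟨ cong (λ l → length (filter (_∈? w) l)) (map-++ suc (upTo j) (j ∷ [])) ⟩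
  length (filter (_∈? w) (map suc (upTo j) ++ suc j ∷ []))
    ≡⟨ cong length (filter-++ (_∈? w) (map suc (upTo j)) (suc j ∷ [])) ⟩
  length (filter (_∈? w) (map suc (upTo j)) ++ filter (_∈? w) (suc j ∷ []))
    ≡⟨ length-++ (filter (_∈? w) (map suc (upTo j))) ⟩
  rank w j + length (filter (_∈? w) (suc j ∷ []))
    ≡⟨ cong (rank w j +_) last ⟩
  rank w j + indicator (occurs (suc j) w) ∎
  where
  open ≡-Reasoning
  last : length (filter (_∈? w) (suc j ∷ [])) ≡ indicator (occurs (suc j) w)
  last with does (suc j ∈? w)
  ... | true  = refl
  ... | false = refl

rank-cong : ∀ w w' j → (∀ i → i < j → occurs (suc i) w ≡ occurs (suc i) w') → rank w j ≡ rank w' j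
rank-cong w w' zero    _ = refl
rank-cong w w' (suc j) h
  rewrite rank-suc w j | rank-suc w' j
        | rank-cong w w' j (λ i i<j → h i (m<n⇒m<1+n i<j)) | h j (n<1+n j) = refl

rank-mono : ∀ w {i j} → i ≤ j → rank w i ≤ rank w j
rank-mono w {i} {j} i≤j = subst (λ k → rank w i ≤ rank w k) (m∸n+n≡m i≤j) (go (j ∸ i))
  where
  go : ∀ d → rank w i ≤ rank w (d + i)
  go zero    = ≤-refl
  go (suc d) rewrite rank-suc w (d + i) = ≤-trans (go d) (m≤m+n _ _)

rank-beyond-sup : ∀ w {j} → sup w ≤ j → rank w j ≡ rank w (sup w)
rank-beyond-sup w {j} p = subst (λ k → rank w k ≡ rank w (sup w)) (m∸n+n≡m p) (go (j ∸ sup w))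
  where
  go : ∀ d → rank w (d + sup w) ≡ rank w (sup w)
  go zero    = refl
  go (suc d) rewrite rank-suc w (d + sup w)
                   | occurs-beyond-sup (suc (d + sup w)) w (s≤s (m≤n+m (sup w) d))
                   | go d = +-identityʳ _

rank-suc-occurring : ∀ w j → occurs (suc j) w ≡ true → rank w (suc j) ≡ suc (rank w j)
rank-suc-occurring w j oc rewrite rank-suc w j | oc = +-comm (rank w j) 1

rank-concat-low : ∀ s A B j → j ≤ s → rank (A ++ map (shiftLetter s) B) j ≡ rank A j
rank-concat-low s A B j j≤s =
  rank-cong _ A j (λ i i<j → occurs-concat-low s A B i (≤-trans i<j j≤s))

rank-concat-high : ∀ s A B → Bounded s A → ∀ k →
                   rank (A ++ map (shiftLetter s) B) (k + s) ≡ rank A s + rank B k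
rank-concat-high s A B bA zero = trans (rank-concat-low s A B s ≤-refl) (sym (+-identityʳ _))
rank-concat-high s A B bA (suc k)
  rewrite rank-suc (A ++ map (shiftLetter s) B) (k + s) | rank-suc B k
        | rank-concat-high s A B bA k | occurs-concat-high s A B k bA
        = +-assoc (rank A s) (rank B k) _

sup-pack : ∀ s A → Bounded s A → sup (pack A) ≡ rank A s
sup-pack s A bA = begin
  sup (map (φ A) A) ≡⟨ sup-map (φ A) φ-mono refl A ⟩
  φ A (sup A)       ≡⟨ φ≡rank A (sup A) ⟩
  rank A (sup A)    ≡⟨ sym (rank-beyond-sup A (sup-bounded A bA)) ⟩
  rank A s          ∎
  where
  open ≡-Reasoning
  φ-mono : ∀ {x y} → x ≤ y → φ A x ≤ φ A y
  φ-mono {x} {y} p = subst₂ _≤_ (sym (φ≡rank A x)) (sym (φ≡rank A y)) (rank-mono A p)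

pack-shifted-concat : ∀ s A B → Bounded s A → pack (A ++ map (shiftLetter s) B) ≡ pack A ✶ pack B
pack-shifted-concat s A B bA = begin
  map φW (A ++ map (shiftLetter s) B)                   ≡⟨ map-++ φW A (map (shiftLetter s) B) ⟩
  map φW A ++ map φW (map (shiftLetter s) B)            ≡⟨ cong₂ _++_ left right ⟩
  pack A ++ map (shiftLetter (sup (pack A))) (pack B)   ≡⟨ cong (pack A ++_) (sym (T≡map-shiftLetter _ (pack B))) ⟩
  pack A ✶ pack B                                       ∎
  where
  open ≡-Reasoning
  φW : ℕ → ℕ
  φW = φ (A ++ map (shiftLetter s) B)
  onA : ∀ x → x ≤ s → φW x ≡ φ A x
  onA x x≤s = begin
    φW x                                   ≡⟨ φ≡rank _ x ⟩
    rank (A ++ map (shiftLetter s) B) x    ≡⟨ rank-concat-low s A B x x≤s ⟩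
    rank A x                               ≡⟨ sym (φ≡rank A x) ⟩
    φ A x                                  ∎
  onB : ∀ y → occurs y B ≡ true → φW (shiftLetter s y) ≡ shiftLetter (sup (pack A)) (φ B y)
  onB zero    _  = refl
  onB (suc k) oc = begin
    rank (A ++ map (shiftLetter s) B) (suc k + s)  ≡⟨ rank-concat-high s A B bA (suc k) ⟩
    rank A s + rank B (suc k)                      ≡⟨ cong (rank A s +_) (rank-suc-occurring B k oc) ⟩
    rank A s + suc (rank B k)                      ≡⟨ +-comm (rank A s) _ ⟩
    suc (rank B k) + rank A s                      ≡⟨ cong (suc (rank B k) +_) (sym (sup-pack s A bA)) ⟩
    suc (rank B k) + sup (pack A)                  ≡⟨ cong (shiftLetter (sup (pack A))) (sym (rank-suc-occurring B k oc)) ⟩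
    shiftLetter (sup (pack A)) (rank B (suc k))    ∎
  left : map φW A ≡ map (φ A) A
  left = map-cong-local (All.map (λ {x} → onA x) bA)
  right : map φW (map (shiftLetter s) B) ≡ map (shiftLetter (sup (pack A))) (map (φ B) B)
  right = begin
    map φW (map (shiftLetter s) B)                       ≡⟨ map-∘ B ⟨
    map (λ y → φW (shiftLetter s y)) B                   ≡⟨ map-cong-local (All.map (λ {y} → onB y) (occurs-self B)) ⟩
    map (λ y → shiftLetter (sup (pack A)) (φ B y)) B     ≡⟨ map-∘ B ⟩
    map (shiftLetter (sup (pack A))) (map (φ B) B)       ∎

quotientLetter : Word → ℕ → ℕ
quotientLetter u i = if occurs i u then 0 else i

quotient-bounded : ∀ {s} A' A → Bounded s A' → Bounded s (A' /ʷ A)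
quotient-bounded [] A [] = []
quotient-bounded (x ∷ A') A (p ∷ ps) with occurs x A
... | true  = z≤n ∷ quotient-bounded A' A ps
... | false = p ∷ quotient-bounded A' A ps

quotient-shifted-concat : ∀ s A' A B' B → Bounded s A' → Bounded s A →
  (A' ++ map (shiftLetter s) B') /ʷ (A ++ map (shiftLetter s) B) ≡ (A' /ʷ A) ++ map (shiftLetter s) (B' /ʷ B)
quotient-shifted-concat s A' A B' B bA' bA = begin
  map qW (A' ++ map (shiftLetter s) B')                     ≡⟨ map-++ qW A' (map (shiftLetter s) B') ⟩
  map qW A' ++ map qW (map (shiftLetter s) B')              ≡⟨ cong₂ _++_ left right ⟩
  map (quotientLetter A) A' ++ map (shiftLetter s) (B' /ʷ B) ∎
  where
  open ≡-Reasoning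
  W : Word
  W = A ++ map (shiftLetter s) B
  qW : ℕ → ℕ
  qW = quotientLetter W
  onA : ∀ x → x ≤ s → qW x ≡ quotientLetter A x
  onA zero    _ rewrite if-eta (occurs 0 W) {0} | if-eta (occurs 0 A) {0} = refl
  onA (suc i) p rewrite occurs-concat-low s A B i p = refl
  onB : ∀ y → qW (shiftLetter s y) ≡ shiftLetter s (quotientLetter B y)
  onB zero rewrite if-eta (occurs 0 W) {0} | if-eta (occurs 0 B) {0} = refl
  onB (suc k) rewrite occurs-concat-high s A B k bA with occurs (suc k) B
  ... | true  = refl
  ... | false = refl
  left : map qW A' ≡ map (quotientLetter A) A'
  left = map-cong-local (All.map (λ {x} → onA x) bA')
  right : map qW (map (shiftLetter s) B') ≡ map (shiftLetter s) (B' /ʷ B)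
  right = begin
    map qW (map (shiftLetter s) B')                   ≡⟨ map-∘ B' ⟨
    map (λ y → qW (shiftLetter s y)) B'               ≡⟨ map-cong onB B' ⟩
    map (λ y → shiftLetter s (quotientLetter B y)) B' ≡⟨ map-∘ B' ⟩
    map (shiftLetter s) (B' /ʷ B)                     ∎

select-++ : ∀ b₁ b₂ (x y : Word) → length b₁ ≡ length x → select (b₁ ++ b₂) (x ++ y) ≡ select b₁ x ++ select b₂ y
select-++ []           b₂ []      y _ = refl
select-++ (true  ∷ b₁) b₂ (a ∷ x) y p = cong (a ∷_) (select-++ b₁ b₂ x y (suc-injective p))
select-++ (false ∷ b₁) b₂ (a ∷ x) y p = select-++ b₁ b₂ x y (suc-injective p)

select-map : ∀ (f : ℕ → ℕ) b w → select b (map f w) ≡ map f (select b w)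
select-map f []          w       = refl
select-map f (true  ∷ b) []      = refl
select-map f (false ∷ b) []      = refl
select-map f (true  ∷ b) (x ∷ w) = cong (f x ∷_) (select-map f b w)
select-map f (false ∷ b) (x ∷ w) = select-map f b w

select-bounded : ∀ {s} b w → Bounded s w → Bounded s (select b w)
select-bounded []          w       _        = []
select-bounded (true  ∷ b) []      _        = []
select-bounded (false ∷ b) []      _        = []
select-bounded (true  ∷ b) (x ∷ w) (p ∷ ps) = p ∷ select-bounded b w ps
select-bounded (false ∷ b) (x ∷ w) (_ ∷ ps) = select-bounded b w ps

ΔTerm : Word → List Bool → Word × Word
ΔTerm w b = pack (select b w) , pack (select (negate b) w /ʷ select b w)

_⊗✶_ : Word × Word → Word × Word → Word × Word
(a , b) ⊗✶ (c , d) = a ✶ c , b ✶ d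

select-✶ : ∀ u v b₁ b₂ → length b₁ ≡ length u →
           select (b₁ ++ b₂) (u ✶ v) ≡ select b₁ u ++ map (shiftLetter (sup u)) (select b₂ v)
select-✶ u v b₁ b₂ len = begin
  select (b₁ ++ b₂) (u ++ T (sup u) v)                   ≡⟨ cong (λ z → select (b₁ ++ b₂) (u ++ z)) (T≡map-shiftLetter (sup u) v) ⟩
  select (b₁ ++ b₂) (u ++ map (shiftLetter (sup u)) v)   ≡⟨ select-++ b₁ b₂ u _ len ⟩
  select b₁ u ++ select b₂ (map (shiftLetter (sup u)) v) ≡⟨ cong (select b₁ u ++_) (select-map _ b₂ v) ⟩
  select b₁ u ++ map (shiftLetter (sup u)) (select b₂ v) ∎
  where open ≡-Reasoning

ΔTerm-✶ : ∀ u v b₁ b₂ → length b₁ ≡ length u → ΔTerm (u ✶ v) (b₁ ++ b₂) ≡ ΔTerm u b₁ ⊗✶ ΔTerm v b₂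
ΔTerm-✶ u v b₁ b₂ len = cong₂ _,_ left right
  where
  open ≡-Reasoning
  s : ℕ
  s = sup u
  A B A' B' : Word
  A  = select b₁ u
  B  = select b₂ v
  A' = select (negate b₁) u
  B' = select (negate b₂) v
  bA : Bounded s A
  bA = select-bounded b₁ u (bounded-sup u)
  bA' : Bounded s A'
  bA' = select-bounded (negate b₁) u (bounded-sup u)
  left : pack (select (b₁ ++ b₂) (u ✶ v)) ≡ pack A ✶ pack B
  left = trans (cong pack (select-✶ u v b₁ b₂ len)) (pack-shifted-concat s A B bA)
  right : pack (select (negate (b₁ ++ b₂)) (u ✶ v) /ʷ select (b₁ ++ b₂) (u ✶ v)) ≡ pack (A' /ʷ A) ✶ pack (B' /ʷ B)
  right = begin
    pack (select (negate (b₁ ++ b₂)) (u ✶ v) /ʷ select (b₁ ++ b₂) (u ✶ v))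
      ≡⟨ cong (λ c → pack (select c (u ✶ v) /ʷ select (b₁ ++ b₂) (u ✶ v))) (map-++ _ b₁ b₂) ⟩
    pack (select (negate b₁ ++ negate b₂) (u ✶ v) /ʷ select (b₁ ++ b₂) (u ✶ v))
      ≡⟨ cong₂ (λ x y → pack (x /ʷ y)) (select-✶ u v (negate b₁) (negate b₂) (trans (length-map _ b₁) len))
                                       (select-✶ u v b₁ b₂ len) ⟩
    pack ((A' ++ map (shiftLetter s) B') /ʷ (A ++ map (shiftLetter s) B))
      ≡⟨ cong pack (quotient-shifted-concat s A' A B' B bA' bA) ⟩
    pack ((A' /ʷ A) ++ map (shiftLetter s) (B' /ʷ B))
      ≡⟨ pack-shifted-concat s (A' /ʷ A) (B' /ʷ B) (quotient-bounded A' A bA') ⟩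
    pack (A' /ʷ A) ✶ pack (B' /ʷ B) ∎

concatMap-↭ : ∀ {A B : Set} (f : A → List B) {xs ys} → xs ↭ ys → concatMap f xs ↭ concatMap f ys
concatMap-↭ f ↭.refl        = ↭.refl
concatMap-↭ f (prep x p)    = ++⁺ˡ (f x) (concatMap-↭ f p)
concatMap-↭ f (swap x y p)  = ↭.trans (++⁺ˡ (f x) (++⁺ˡ (f y) (concatMap-↭ f p))) (shifts (f x) (f y))
concatMap-↭ f (↭.trans p q) = ↭.trans (concatMap-↭ f p) (concatMap-↭ f q)

interleave-↭ : ∀ {A B : Set} (a b : A → B) xs → concatMap (λ x → a x ∷ b x ∷ []) xs ↭ map a xs ++ map b xs
interleave-↭ a b []       = ↭.refl
interleave-↭ a b (x ∷ xs) =
  prep (a x) (↭.trans (prep (b x) (interleave-↭ a b xs)) (↭-sym (shift (b x) (map a xs) (map b xs))))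

extendMask : List Bool → List (List Bool)
extendMask b = (true ∷ b) ∷ (false ∷ b) ∷ []

concatenations : List (List Bool) → List (List Bool) → List (List Bool)
concatenations M N = concatMap (λ b₁ → map (b₁ ++_) N) M

extend-concatenations : ∀ M N → concatMap extendMask (concatenations M N) ↭ concatenations (concatMap extendMask M) N
extend-concatenations []       N = ↭.refl
extend-concatenations (b₁ ∷ M) N = begin
  concatMap extendMask (map (b₁ ++_) N ++ concatenations M N)
    ≡⟨ concatMap-++ extendMask (map (b₁ ++_) N) (concatenations M N) ⟩
  concatMap extendMask (map (b₁ ++_) N) ++ concatMap extendMask (concatenations M N)
    ↭⟨ ++⁺ head (extend-concatenations M N) ⟩
  (map ((true ∷ b₁) ++_) N ++ map ((false ∷ b₁) ++_) N) ++ concatenations (concatMap extendMask M) N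
    ≡⟨ ++-assoc (map ((true ∷ b₁) ++_) N) _ _ ⟩
  concatenations (concatMap extendMask (b₁ ∷ M)) N ∎
  where
  open PermutationReasoning
  head : concatMap extendMask (map (b₁ ++_) N) ↭ map ((true ∷ b₁) ++_) N ++ map ((false ∷ b₁) ++_) N
  head = ↭.trans (↭-reflexive (concatMap-map extendMask (b₁ ++_) N)) (interleave-↭ _ _ N)

masks-+ : ∀ m n → masks (m + n) ↭ concatenations (masks m) (masks n)
masks-+ zero    n = ↭-reflexive (trans (sym (map-id (masks n))) (sym (++-identityʳ _)))
masks-+ (suc m) n = ↭.trans (concatMap-↭ extendMask (masks-+ m n)) (extend-concatenations (masks m) (masks n))

masks-length : ∀ m → All (λ b → length b ≡ m) (masks m)
masks-length zero    = refl ∷ []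
masks-length (suc m) = Allₚ.concat⁺ (Allₚ.map⁺ (All.map (λ p → cong suc p ∷ cong suc p ∷ []) (masks-length m)))

✶⊗-map : ∀ {A B : Set} (f : A → Word × Word) (g : B → Word × Word) xs ys →
         map f xs ✶⊗ map g ys ≡ concatMap (λ x → map (λ y → f x ⊗✶ g y) ys) xs
✶⊗-map f g []       ys = refl
✶⊗-map f g (x ∷ xs) ys = cong₂ _++_ (sym (map-∘ ys)) (✶⊗-map f g xs ys)

length-✶ : ∀ u v → length (u ✶ v) ≡ length u + length v
length-✶ u v = trans (length-++ u) (cong (length u +_) (length-map _ v))

Δ-✶-↭ : ∀ u v → Δ (u ✶ v) ↭ Δ u ✶⊗ Δ v
Δ-✶-↭ u v = begin
  map (ΔTerm (u ✶ v)) (masks (length (u ✶ v)))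
    ≡⟨ cong (λ k → map (ΔTerm (u ✶ v)) (masks k)) (length-✶ u v) ⟩
  map (ΔTerm (u ✶ v)) (masks (length u + length v))
    ↭⟨ map⁺ (ΔTerm (u ✶ v)) (masks-+ (length u) (length v)) ⟩
  map (ΔTerm (u ✶ v)) (concatenations Mu Mv)
    ≡⟨ map-concatMap (ΔTerm (u ✶ v)) _ Mu ⟩
  concatMap (λ b₁ → map (ΔTerm (u ✶ v)) (map (b₁ ++_) Mv)) Mu
    ≡⟨ cong concat (map-cong-local (All.map (λ {b₁} → factor b₁) (masks-length (length u)))) ⟩
  concatMap (λ b₁ → map (λ b₂ → ΔTerm u b₁ ⊗✶ ΔTerm v b₂) Mv) Mu
    ≡⟨ ✶⊗-map (ΔTerm u) (ΔTerm v) Mu Mv ⟨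
  Δ u ✶⊗ Δ v ∎
  where
  open PermutationReasoning
  Mu Mv : List (List Bool)
  Mu = masks (length u)
  Mv = masks (length v)
  factor : ∀ b₁ → length b₁ ≡ length u →
           map (ΔTerm (u ✶ v)) (map (b₁ ++_) Mv) ≡ map (λ b₂ → ΔTerm u b₁ ⊗✶ ΔTerm v b₂) Mv
  factor b₁ len = trans (sym (map-∘ Mv)) (map-cong (λ b₂ → ΔTerm-✶ u v b₁ b₂ len) Mv)

coeff-↭ : ∀ {c ℓ} (K : Field c ℓ) (p : Word × Word) {X Y : Tensor} → X ↭ Y →
          Field._≈_ K (coeff K p X) (coeff K p Y)
coeff-↭ K p ↭.refl = Field.refl K
coeff-↭ K p (prep q r) with q ==ᵗ p
... | true  = Field.+-cong K (Field.refl K) (coeff-↭ K p r)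
... | false = coeff-↭ K p r
coeff-↭ K p (swap q q' r) with q ==ᵗ p | q' ==ᵗ p
... | true  | true  = Field.+-cong K (Field.refl K) (Field.+-cong K (Field.refl K) (coeff-↭ K p r))
... | true  | false = Field.+-cong K (Field.refl K) (coeff-↭ K p r)
... | false | true  = Field.+-cong K (Field.refl K) (coeff-↭ K p r)
... | false | false = coeff-↭ K p r
coeff-↭ K p (↭.trans r s) = Field.trans K (coeff-↭ K p r) (coeff-↭ K p s)

-- Theorem: Δ(u * v) = Δ(u) *⊗ Δ(v), compared coefficientwise over K.  It holds for
-- arbitrary words; the packedness hypotheses only restrict u, v to basis elements of H.
mainTheorem12 : ∀ {c ℓ} (K : Field c ℓ) (u v : Word) → IsPacked u → IsPacked v →
    ∀ (p : Word × Word) → Field._≈_ K (coeff K p (Δ (u ✶ v))) (coeff K p (Δ u ✶⊗ Δ v))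
mainTheorem12 K u v _ _ p = coeff-↭ K p (Δ-✶-↭ u v)
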